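{- Every $n \in \mathbb{Z}_{\ge 1}$ has exactly two alternating binary expansions, i.e. there are exactly two tuples $(l_0,\dotsc,l_d)$ with $d,l_0\in\mathbb{Z}_{\ge 0}$, $l_1,\dotsc,l_d\in\mathbb{Z}_{\ge 1}$ and $n = A(l_0,\dotsc,l_d)$. Exactly one of these has the form $n = A(l_0, 1, l_2, \dotsc, l_d)$ with $l_0 \in \mathbb{Z}_{\ge 0}$ and $d, l_2, \dotsc, l_d \in \mathbb{Z}_{\ge 1}$. If $n$ is a power of $2$, then this one has $d = 1$ and the other expansion is $n = A(l_0)$; otherwise $d \ge 2$ and the other expansion is $n = A(l_0, l_2+1, l_3, \dotsc, l_d)$.
   Context: For $d, l_0 \in \mathbb{Z}_{\ge 0}$ and $l_1,\dotsc,l_d \in \mathbb{Z}_{\ge 1}$, the alternating binary expansion is defined by $A(l_0, \dotsc, l_d) = \sum_{i=0}^d (-1)^{d-i} 2^{l_0+\dotsb+l_i}$. -}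

module Defs where

open import Data.Nat using (ℕ; _+_; _∸_; _≤_; _^_)
open import Data.Integer as ℤ using (ℤ; +_; -1ℤ; 0ℤ)
open import Data.List using (List; []; _∷_; length; scanl; zip; upTo; map; foldr)
open import Data.List.Relation.Unary.All using (All)
open import Data.Product using (_×_; _,_; ∃)
open import Relation.Binary.PropositionalEquality using (_≡_)

-- A tuple (l₀, l₁, …, l_d) is represented as the pair (l₀ , [l₁, …, l_d]);
-- d is the length of the list.
Tuple : Set
Tuple = ℕ × List ℕ

Valid : Tuple → Set
Valid (l₀ , ls) = All (λ l → 1 ≤ l) ls

sumℤ : List ℤ → ℤ
sumℤ = foldr ℤ._+_ 0ℤ

-- A(l₀,…,l_d) = Σ_{i=0}^{d} (-1)^{d-i} 2^{l₀+⋯+l_i}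
-- The partial sums l₀+⋯+l_i (i = 0..d) are  scanl _+_ l₀ ls.
A : Tuple → ℤ
A (l₀ , ls) =
  sumℤ (map (λ { (i , s) → (-1ℤ ℤ.^ (d ∸ i)) ℤ.* (+ (2 ^ s)) })
            (zip (upTo (1 + d)) (scanl _+_ l₀ ls)))
  where
  d : ℕ
  d = length ls

HasOneForm : Tuple → Set
HasOneForm e = ∃ λ l₀ → ∃ λ rest → e ≡ (l₀ , 1 ∷ rest)

IsPowerOf2 : ℕ → Set
IsPowerOf2 n = ∃ λ k → n ≡ 2 ^ k

-- Write the partial sums of (l₀, …, l_d) as s₀ < s₁ < ⋯ < s_d = top. Peeling off the
-- last entry gives A(l₀, …, l_d) = 2^top − A(l₀, …, l_{d-1}), and by induction
-- A ≤ 2^top ≤ 2A, with 2^top = A only for d = 0. Hence if 2^t < n < 2^(t+1) every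
-- expansion of n has top = t + 1 and d ≥ 1, and removing its last entry is a bijection
-- onto the expansions of the smaller number 2^(t+1) − n, whose tops are at most t.
-- Strong induction on n then reduces everything to n = 2^t, whose only expansions are
-- (t) and (t, 1).
module Submission where

open import Defs
open import Data.Integer as ℤ using (ℤ; +_; -1ℤ; 0ℤ)
import Data.Integer.Properties as ℤ
open import Data.Integer.Tactic.RingSolver using (solve-∀)
open import Data.List using (List; []; _∷_; _∷ʳ_; length; foldl; scanl; zip; applyUpTo; upTo; map)
open import Data.List.Properties using (foldl-∷ʳ; length-++; map-cong)
open import Data.List.Relation.Unary.All using ([]; _∷_)
open import Data.List.Relation.Unary.All.Properties using (∷ʳ⁺; ∷ʳ⁻)
open import Data.List.Reverse using (Reverse; []; _∶_∶ʳ_; reverseView)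
open import Data.Nat using (ℕ; zero; suc; _+_; _*_; _∸_; _^_; _≤_; _<_; z≤n; s≤s)
open import Data.Nat.Induction using (<-rec)
open import Data.Nat.Properties
open import Data.Product using (Σ; ∃; _×_; _,_; proj₁; proj₂)
open import Data.Sum using (_⊎_; inj₁; inj₂)
import Data.Sum as Sum
open import Function using (_∘_; id)
open import Relation.Nullary using (¬_; contradiction)
open import Relation.Binary.PropositionalEquality

private variable
  l n v : ℕ
  e : Tuple

2^-reflects-≤ : ∀ m n → 2 ^ m ≤ 2 ^ n → m ≤ n
2^-reflects-≤ m n 2^m≤2^n = ≮⇒≥ (λ n<m → <⇒≱ (^-monoʳ-< 2 (n<1+n 1) n<m) 2^m≤2^n)

2^-reflects-< : ∀ m n → 2 ^ m < 2 ^ n → m < n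
2^-reflects-< m n 2^m<2^n = ≰⇒> (λ n≤m → <⇒≱ 2^m<2^n (^-monoʳ-≤ 2 n≤m))

2^-injective : ∀ m n → 2 ^ m ≡ 2 ^ n → m ≡ n
2^-injective m n eq = ≤-antisym (2^-reflects-≤ m n (≤-reflexive eq)) (2^-reflects-≤ n m (≤-reflexive (sym eq)))

2^[1+t]∸2^t : ∀ t → 2 ^ suc t ∸ 2 ^ t ≡ 2 ^ t
2^[1+t]∸2^t t = trans (m+n∸m≡n (2 ^ t) (2 ^ t + 0)) (+-identityʳ (2 ^ t))

2^t<2^[1+t] : ∀ t → 2 ^ t < 2 ^ suc t
2^t<2^[1+t] t = ^-monoʳ-< 2 (n<1+n 1) (n<1+n t)

PowerOrBetween : ℕ → Set
PowerOrBetween n = ∃ λ t → n ≡ 2 ^ t ⊎ (2 ^ t < n × n < 2 ^ suc t)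

power-or-between-≤ : ∀ t → 2 ^ t < n → n ≤ 2 ^ suc t → PowerOrBetween n
power-or-between-≤ t lo hi with m≤n⇒m<n∨m≡n hi
... | inj₁ lt = t , inj₂ (lo , lt)
... | inj₂ eq = suc t , inj₁ eq

power-or-between : ∀ n → 1 ≤ n → PowerOrBetween n
power-or-between (suc zero)      _ = 0 , inj₁ refl
power-or-between (suc n@(suc _)) _ with power-or-between n (s≤s z≤n)
... | t , inj₁ n≡2^t      =
  power-or-between-≤ t (s≤s (≤-reflexive (sym n≡2^t))) (subst (_< 2 ^ suc t) (sym n≡2^t) (2^t<2^[1+t] t))
... | t , inj₂ (lo , hi) = power-or-between-≤ t (m<n⇒m<1+n lo) hi

between⇒¬power : ∀ t → 2 ^ t < n → n < 2 ^ suc t → ¬ IsPowerOf2 n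
between⇒¬power t lo hi (k , refl) = <⇒≱ (2^-reflects-< t k lo) (≤-pred (2^-reflects-< k (suc t) hi))

top : Tuple → ℕ
top (l₀ , ls) = foldl _+_ l₀ ls

_▷_ : Tuple → ℕ → Tuple
(l₀ , ls) ▷ l = l₀ , ls ∷ʳ l

top-▷ : ∀ e l → top (e ▷ l) ≡ top e + l
top-▷ (l₀ , ls) l = foldl-∷ʳ _+_ l₀ l ls

data TupleView : Tuple → Set where
  [_]  : ∀ l₀ → TupleView (l₀ , [])
  _▷ᵛ_ : TupleView e → ∀ l → TupleView (e ▷ l)

tupleView : ∀ e → TupleView e
tupleView (l₀ , ls) = fromReverse (reverseView ls)
  where
  fromReverse : ∀ {ls} → Reverse ls → TupleView (l₀ , ls)
  fromReverse []             = [ l₀ ]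
  fromReverse (_ ∶ r ∶ʳ l) = fromReverse r ▷ᵛ l

-- The sign of 2^s is (-1)^(number of later partial sums), so appending one more
-- partial sum negates everything already there.
altPowers : List ℕ → ℤ
altPowers []       = 0ℤ
altPowers (s ∷ ss) = (-1ℤ ℤ.^ length ss) ℤ.* (+ (2 ^ s)) ℤ.+ altPowers ss

signedPower : ℕ → ℕ × ℕ → ℤ
signedPower d (i , s) = (-1ℤ ℤ.^ (d ∸ i)) ℤ.* (+ (2 ^ s))

sum-signedPower : ∀ d (f : ℕ → ℕ) ss → (∀ i → d ∸ f i ≡ length ss ∸ suc i) →
  sumℤ (map (signedPower d) (zip (applyUpTo f (length ss)) ss)) ≡ altPowers ss
sum-signedPower d f []       _  = refl
sum-signedPower d f (s ∷ ss) hf =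
  cong₂ ℤ._+_ (cong (λ k → (-1ℤ ℤ.^ k) ℤ.* (+ (2 ^ s))) (hf 0))
              (sum-signedPower d (f ∘ suc) ss (hf ∘ suc))

length-scanl : ∀ {A B : Set} (f : A → B → A) x ys → length (scanl f x ys) ≡ suc (length ys)
length-scanl f x []       = refl
length-scanl f x (y ∷ ys) = cong suc (length-scanl f (f x y) ys)

scanl-∷ʳ : ∀ {A B : Set} (f : A → B → A) x ys y →
  scanl f x (ys ∷ʳ y) ≡ scanl f x ys ∷ʳ f (foldl f x ys) y
scanl-∷ʳ f x []       y = refl
scanl-∷ʳ f x (z ∷ ys) y = cong (x ∷_) (scanl-∷ʳ f (f x z) ys y)

A≡altPowers : ∀ l₀ ls → A (l₀ , ls) ≡ altPowers (scanl _+_ l₀ ls)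
A≡altPowers l₀ ls = begin
  A (l₀ , ls)
    ≡⟨ cong sumℤ (map-cong {g = signedPower d} (λ _ → refl) (zip (upTo (suc d)) ss)) ⟩
  sumℤ (map (signedPower d) (zip (upTo (suc d)) ss))
    ≡⟨ cong (λ k → sumℤ (map (signedPower d) (zip (upTo k) ss))) (sym |ss|≡1+d) ⟩
  sumℤ (map (signedPower d) (zip (upTo (length ss)) ss))
    ≡⟨ sum-signedPower d id ss (λ i → cong (_∸ suc i) (sym |ss|≡1+d)) ⟩
  altPowers ss ∎
  where
  open ≡-Reasoning
  d = length ls
  ss = scanl _+_ l₀ ls
  |ss|≡1+d : length ss ≡ suc d
  |ss|≡1+d = length-scanl _+_ l₀ ls

altPowers-∷ʳ : ∀ ss s → altPowers (ss ∷ʳ s) ≡ + (2 ^ s) ℤ.- altPowers ss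
altPowers-∷ʳ []       s = cong (ℤ._+ 0ℤ) (ℤ.*-identityˡ (+ (2 ^ s)))
altPowers-∷ʳ (x ∷ ss) s = begin
  (-1ℤ ℤ.^ length (ss ∷ʳ s)) ℤ.* a ℤ.+ altPowers (ss ∷ʳ s)
    ≡⟨ cong₂ (λ k w → (-1ℤ ℤ.^ k) ℤ.* a ℤ.+ w) |ss∷ʳs|≡1+|ss| (altPowers-∷ʳ ss s) ⟩
  (-1ℤ ℤ.* σ) ℤ.* a ℤ.+ (b ℤ.- altPowers ss)
    ≡⟨ alternate σ a b (altPowers ss) ⟩
  b ℤ.- (σ ℤ.* a ℤ.+ altPowers ss) ∎
  where
  open ≡-Reasoning
  σ = -1ℤ ℤ.^ length ss
  a = + (2 ^ x)
  b = + (2 ^ s)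
  |ss∷ʳs|≡1+|ss| : length (ss ∷ʳ s) ≡ suc (length ss)
  |ss∷ʳs|≡1+|ss| = trans (length-++ ss) (+-comm (length ss) 1)
  alternate : ∀ σ a b w → (-1ℤ ℤ.* σ) ℤ.* a ℤ.+ (b ℤ.- w) ≡ b ℤ.- (σ ℤ.* a ℤ.+ w)
  alternate = solve-∀

A-singleton : ∀ l₀ → A (l₀ , []) ≡ + (2 ^ l₀)
A-singleton l₀ = trans (ℤ.+-identityʳ _) (ℤ.*-identityˡ (+ (2 ^ l₀)))

A-▷ : ∀ e l → A (e ▷ l) ≡ + (2 ^ (top e + l)) ℤ.- A e
A-▷ (l₀ , ls) l = begin
  A (l₀ , ls ∷ʳ l)                                      ≡⟨ A≡altPowers l₀ (ls ∷ʳ l) ⟩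
  altPowers (scanl _+_ l₀ (ls ∷ʳ l))                    ≡⟨ cong altPowers (scanl-∷ʳ _+_ l₀ ls l) ⟩
  altPowers (scanl _+_ l₀ ls ∷ʳ (top (l₀ , ls) + l))    ≡⟨ altPowers-∷ʳ (scanl _+_ l₀ ls) _ ⟩
  + (2 ^ (top (l₀ , ls) + l)) ℤ.- altPowers (scanl _+_ l₀ ls)
    ≡⟨ cong (ℤ._-_ (+ (2 ^ (top (l₀ , ls) + l)))) (sym (A≡altPowers l₀ ls)) ⟩
  + (2 ^ (top (l₀ , ls) + l)) ℤ.- A (l₀ , ls)           ∎
  where open ≡-Reasoning

Expansion : ℕ → Tuple → Set
Expansion n e = Valid e × A e ≡ + n

expansion-singleton : ∀ l₀ → Expansion (2 ^ l₀) (l₀ , [])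
expansion-singleton l₀ = [] , A-singleton l₀

expansion-▷ : Expansion v e → 1 ≤ l → v ≤ 2 ^ (top e + l) → Expansion (2 ^ (top e + l) ∸ v) (e ▷ l)
expansion-▷ {v} {e} {l} (valid , A≡v) 1≤l v≤2^T = ∷ʳ⁺ valid 1≤l , (begin
  A (e ▷ l)                         ≡⟨ A-▷ e l ⟩
  + (2 ^ (top e + l)) ℤ.- A e       ≡⟨ cong (ℤ._-_ (+ (2 ^ (top e + l)))) A≡v ⟩
  + (2 ^ (top e + l)) ℤ.- + v       ≡⟨ ℤ.m-n≡m⊖n (2 ^ (top e + l)) v ⟩
  2 ^ (top e + l) ℤ.⊖ v             ≡⟨ ℤ.⊖-≥ v≤2^T ⟩
  + (2 ^ (top e + l) ∸ v)           ∎)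
  where open ≡-Reasoning

Bracketed : ℕ → ℕ → Set
Bracketed k n = n ≤ 2 ^ k × 2 ^ k ≤ 2 * n

bracketed⇒positive : ∀ k → Bracketed k n → 1 ≤ n
bracketed⇒positive {zero}  k (_ , 2^k≤0) = contradiction 2^k≤0 (<⇒≱ (m^n>0 2 k))
bracketed⇒positive {suc n} k _           = s≤s z≤n

bracketed-∸ : ∀ k → Bracketed k v → 1 ≤ l → v ≤ 2 ^ (k + l) × Bracketed (k + l) (2 ^ (k + l) ∸ v)
bracketed-∸ {v} {l} k (v≤2^T , _) 1≤l = ≤-trans (m≤n*m v 2) 2v≤P , m∸n≤m P v , P≤2[P∸v]
  where
  P = 2 ^ (k + l)
  2v≤P : 2 * v ≤ P
  2v≤P = ≤-trans (*-monoʳ-≤ 2 v≤2^T) (^-monoʳ-≤ 2 (m<m+n k 1≤l))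
  P≤2[P∸v] : P ≤ 2 * (P ∸ v)
  P≤2[P∸v] = subst (P ≤_) (sym (*-distribˡ-∸ 2 P v))
    (m+n≤o⇒m≤o∸n P (subst (P + 2 * v ≤_) (cong (λ x → P + x) (sym (+-identityʳ P))) (+-monoʳ-≤ P 2v≤P)))

valid⇒bracketed : Valid e → ∃ λ n → Expansion n e × Bracketed (top e) n
valid⇒bracketed {e} = go (tupleView e)
  where
  go : ∀ {e} → TupleView e → Valid e → ∃ λ n → Expansion n e × Bracketed (top e) n
  go [ l₀ ] _ = 2 ^ l₀ , expansion-singleton l₀ , ≤-refl , m≤n*m (2 ^ l₀) 2
  go (_▷ᵛ_ {e} w l) valid =
    let valid-e , 1≤l   = ∷ʳ⁻ valid
        v , x , bracket = go w valid-e
        v≤P , bracket′  = bracketed-∸ (top e) bracket 1≤l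
    in  _ , expansion-▷ x 1≤l v≤P , subst (λ k → Bracketed k (2 ^ (top e + l) ∸ v)) (sym (top-▷ e l)) bracket′

expansion⇒bracketed : Expansion n e → Bracketed (top e) n
expansion⇒bracketed {e = e} (valid , A≡n) =
  let v , (_ , A≡v) , bracket = valid⇒bracketed valid
  in  subst (Bracketed (top e)) (ℤ.+-injective (trans (sym A≡v) A≡n)) bracket

expansion-▷⁻¹ : Expansion n (e ▷ l) → ∃ λ v → Expansion v e × 1 ≤ v × n + v ≡ 2 ^ (top e + l)
expansion-▷⁻¹ {n} {e} {l} (valid , A≡n) =
  let valid-e , 1≤l   = ∷ʳ⁻ valid
      v , x , bracket = valid⇒bracketed valid-e
      v≤P , _         = bracketed-∸ (top e) bracket 1≤l
      n≡P∸v           = ℤ.+-injective (trans (sym A≡n) (proj₂ (expansion-▷ x 1≤l v≤P)))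
  in  v , x , bracketed⇒positive (top e) bracket , trans (cong (_+ v) n≡P∸v) (m∸n+n≡m v≤P)

expansion-▷-< : Expansion n (e ▷ l) → n < 2 ^ (top e + l)
expansion-▷-< {n} x = let _ , _ , 1≤v , n+v≡P = expansion-▷⁻¹ x in subst (n <_) n+v≡P (m<m+n n 1≤v)

exponent-≡-suc : ∀ t T → 2 ^ t ≤ n → n < 2 ^ suc t → n < 2 ^ T → 2 ^ T ≤ 2 * n → T ≡ suc t
exponent-≡-suc t T lo hi n<2^T 2^T≤2n = ≤-antisym (≤-pred T<2+t) t<T
  where
  t<T = 2^-reflects-< t T (≤-<-trans lo n<2^T)
  T<2+t = 2^-reflects-< T (2 + t) (≤-<-trans 2^T≤2n (*-monoʳ-< 2 hi))

expansion-▷-split : ∀ t → 2 ^ t ≤ n → n < 2 ^ suc t → Expansion n (e ▷ l) →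
  top e + l ≡ suc t × Expansion (2 ^ suc t ∸ n) e
expansion-▷-split {n} {e} {l} t lo hi x with expansion-▷⁻¹ x
... | w , xʷ , _ , n+w≡P = T≡1+t , subst (λ u → Expansion u e) w≡2^[1+t]∸n xʷ
  where
  open ≡-Reasoning
  2^T≤2n = subst (λ k → 2 ^ k ≤ 2 * n) (top-▷ e l) (proj₂ (expansion⇒bracketed x))
  T≡1+t = exponent-≡-suc t (top e + l) lo hi (expansion-▷-< x) 2^T≤2n
  w≡2^[1+t]∸n : w ≡ 2 ^ suc t ∸ n
  w≡2^[1+t]∸n = begin
    w                      ≡⟨ m+n∸m≡n n w ⟨
    n + w ∸ n              ≡⟨ cong (_∸ n) n+w≡P ⟩
    2 ^ (top e + l) ∸ n    ≡⟨ cong (λ k → 2 ^ k ∸ n) T≡1+t ⟩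
    2 ^ suc t ∸ n          ∎

PowerPair : Tuple → Tuple → Set
PowerPair e₁ e₂ = ∃ λ l₀ → e₁ ≡ (l₀ , 1 ∷ []) × e₂ ≡ (l₀ , [])

SplitPair : Tuple → Tuple → Set
SplitPair e₁ e₂ = ∃ λ l₀ → ∃ λ l₂ → ∃ λ rest → e₁ ≡ (l₀ , 1 ∷ l₂ ∷ rest) × e₂ ≡ (l₀ , suc l₂ ∷ rest)

record ExpansionPair (n : ℕ) : Set where
  field
    e₁ e₂       : Tuple
    expansion₁  : Expansion n e₁
    expansion₂  : Expansion n e₂
    complete    : ∀ e → Expansion n e → e ≡ e₁ ⊎ e ≡ e₂
    one-form₁   : HasOneForm e₁
    ¬one-form₂  : ¬ HasOneForm e₂
    power-shape : IsPowerOf2 n → PowerPair e₁ e₂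
    split-shape : ¬ IsPowerOf2 n → SplitPair e₁ e₂

power-complete : ∀ t → Expansion (2 ^ t) e → e ≡ (t , 1 ∷ []) ⊎ e ≡ (t , [])
power-complete {e} t = go (tupleView e)
  where
  split : ∀ {e l} → Expansion (2 ^ t) (e ▷ l) → top e + l ≡ suc t × Expansion (2 ^ suc t ∸ 2 ^ t) e
  split = expansion-▷-split t ≤-refl (2^t<2^[1+t] t)

  go : ∀ {e} → TupleView e → Expansion (2 ^ t) e → e ≡ (t , 1 ∷ []) ⊎ e ≡ (t , [])
  go [ l₀ ] (_ , A≡2^t) =
    inj₂ (cong (_, []) (2^-injective l₀ t (ℤ.+-injective (trans (sym (A-singleton l₀)) A≡2^t))))
  go ([ l₀ ] ▷ᵛ l) x with split {l₀ , []} {l} x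
  ... | l₀+l≡1+t , (_ , A≡) = inj₁ (cong₂ (λ a b → a , b ∷ []) l₀≡t l≡1)
    where
    l₀≡t : l₀ ≡ t
    l₀≡t = 2^-injective l₀ t (ℤ.+-injective
      (trans (sym (A-singleton l₀)) (trans A≡ (cong +_ (2^[1+t]∸2^t t)))))
    l≡1 : l ≡ 1
    l≡1 = +-cancelˡ-≡ t l 1 (trans (cong (_+ l) (sym l₀≡t)) (trans l₀+l≡1+t (+-comm 1 t)))
  go (_▷ᵛ_ {e′} (_▷ᵛ_ {e″} _ l′) l) x with split {e′} {l} x
  ... | T≡1+t , x′ = contradiction top≤t (<⇒≱ t<top)
    where
    t<top : t < top e′
    t<top = 2^-reflects-< t (top e′) (subst (2 ^ t <_) (cong (2 ^_) (sym (top-▷ e″ l′)))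
      (expansion-▷-< (subst (λ u → Expansion u e′) (2^[1+t]∸2^t t) x′)))
    top≤t : top e′ ≤ t
    top≤t = ≤-pred (subst (suc (top e′) ≤_) T≡1+t (m<m+n (top e′) (proj₂ (∷ʳ⁻ (proj₁ x)))))

power-pair : ∀ t → ExpansionPair (2 ^ t)
power-pair t = record
  { e₁          = t , 1 ∷ []
  ; e₂          = t , []
  ; expansion₁  = subst (λ u → Expansion u (t , 1 ∷ [])) 2^[t+1]∸2^t
                    (expansion-▷ {e = t , []} (expansion-singleton t) ≤-refl (^-monoʳ-≤ 2 (m≤m+n t 1)))
  ; expansion₂  = expansion-singleton t
  ; complete    = λ _ → power-complete t
  ; one-form₁   = t , [] , refl
  ; ¬one-form₂  = λ { (_ , _ , ()) }
  ; power-shape = λ _ → t , refl , refl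
  ; split-shape = λ ¬power → contradiction (t , refl) ¬power
  }
  where
  2^[t+1]∸2^t : 2 ^ (t + 1) ∸ 2 ^ t ≡ 2 ^ t
  2^[t+1]∸2^t = trans (cong (λ k → 2 ^ k ∸ 2 ^ t) (+-comm t 1)) (2^[1+t]∸2^t t)

extendTo : ℕ → Tuple → Tuple
extendTo k e = e ▷ (k ∸ top e)

complement-< : ∀ t → 2 ^ t < n → n < 2 ^ suc t → 2 ^ suc t ∸ n < 2 ^ t
complement-< {n} t lo hi = subst (2 ^ suc t ∸ n <_) (2^[1+t]∸2^t t) (∸-monoʳ-< lo (<⇒≤ hi))

expansion-top-≤ : ∀ {m} t → Expansion m e → m < 2 ^ t → top e ≤ t
expansion-top-≤ {e = e} t x m<2^t =
  ≤-pred (2^-reflects-< (top e) (suc t) (≤-<-trans (proj₂ (expansion⇒bracketed x)) (*-monoʳ-< 2 m<2^t)))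

extend-expansion : ∀ t → 2 ^ t < n → n < 2 ^ suc t → Expansion (2 ^ suc t ∸ n) e →
  Expansion n (extendTo (suc t) e)
extend-expansion {n} {e} t lo hi x = subst (λ u → Expansion u (e ▷ l′)) 2^T∸m≡n (expansion-▷ x 1≤l′ m≤2^T)
  where
  m = 2 ^ suc t ∸ n
  l′ = suc t ∸ top e
  top≤t = expansion-top-≤ t x (complement-< t lo hi)
  1≤l′ : 1 ≤ l′
  1≤l′ = m<n⇒0<n∸m (s≤s top≤t)
  T≡1+t : top e + l′ ≡ suc t
  T≡1+t = m+[n∸m]≡n (m≤n⇒m≤1+n top≤t)
  m≤2^T : m ≤ 2 ^ (top e + l′)
  m≤2^T = subst (λ k → m ≤ 2 ^ k) (sym T≡1+t) (m∸n≤m (2 ^ suc t) n)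
  2^T∸m≡n : 2 ^ (top e + l′) ∸ m ≡ n
  2^T∸m≡n = trans (cong (λ k → 2 ^ k ∸ m) T≡1+t) (m∸[m∸n]≡n (<⇒≤ hi))

expansion⇒extended : ∀ t → 2 ^ t < n → n < 2 ^ suc t → Expansion n e →
  ∃ λ e′ → Expansion (2 ^ suc t ∸ n) e′ × e ≡ extendTo (suc t) e′
expansion⇒extended {n} {e} t lo hi = go (tupleView e)
  where
  go : ∀ {e} → TupleView e → Expansion n e → ∃ λ e′ → Expansion (2 ^ suc t ∸ n) e′ × e ≡ extendTo (suc t) e′
  go [ l₀ ] (_ , A≡n) =
    contradiction (l₀ , ℤ.+-injective (trans (sym A≡n) (A-singleton l₀))) (between⇒¬power t lo hi)
  go (_▷ᵛ_ {e′} _ l) x with expansion-▷-split t (<⇒≤ lo) hi x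
  ... | T≡1+t , x′ = e′ , x′ , cong (e′ ▷_) (sym (trans (cong (_∸ top e′) (sym T≡1+t)) (m+n∸m≡n (top e′) l)))

extend-power-pair : ∀ {e₁ e₂} k → top e₁ ≤ k → PowerPair e₁ e₂ → SplitPair (extendTo k e₁) (extendTo k e₂)
extend-power-pair k l₀+1≤k (l₀ , refl , refl) = l₀ , k ∸ (l₀ + 1) , [] , refl , cong (λ l → l₀ , l ∷ []) k∸l₀≡
  where
  open ≡-Reasoning
  k∸l₀≡ : k ∸ l₀ ≡ suc (k ∸ (l₀ + 1))
  k∸l₀≡ = begin
    k ∸ l₀                ≡⟨ cong (suc k ∸_) (+-comm 1 l₀) ⟩
    suc k ∸ (l₀ + 1)      ≡⟨ +-∸-assoc 1 l₀+1≤k ⟩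
    suc (k ∸ (l₀ + 1))    ∎

extend-split-pair : ∀ {e₁ e₂} k → SplitPair e₁ e₂ → SplitPair (extendTo k e₁) (extendTo k e₂)
extend-split-pair k (l₀ , l₂ , rest , refl , refl) =
  l₀ , l₂ , rest ∷ʳ (k ∸ top (l₀ , 1 ∷ l₂ ∷ rest)) , refl ,
  cong (λ s → l₀ , suc l₂ ∷ rest ∷ʳ (k ∸ foldl _+_ s rest)) (sym (+-assoc l₀ 1 l₂))

split-pair-one-forms : ∀ {e₁ e₂} → Valid e₁ → SplitPair e₁ e₂ → HasOneForm e₁ × ¬ HasOneForm e₂
split-pair-one-forms (_ ∷ s≤s z≤n ∷ _) (l₀ , l₂ , rest , refl , refl) = (l₀ , l₂ ∷ rest , refl) , λ { (_ , _ , ()) }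

extend-pair : ∀ t → 2 ^ t < n → n < 2 ^ suc t → ExpansionPair (2 ^ suc t ∸ n) → ExpansionPair n
extend-pair {n} t lo hi p = record
  { e₁          = extendTo (suc t) e₁
  ; e₂          = extendTo (suc t) e₂
  ; expansion₁  = extended₁
  ; expansion₂  = extend-expansion t lo hi expansion₂
  ; complete    = complete′
  ; one-form₁   = proj₁ (split-pair-one-forms (proj₁ extended₁) split)
  ; ¬one-form₂  = proj₂ (split-pair-one-forms (proj₁ extended₁) split)
  ; power-shape = λ power → contradiction power (between⇒¬power t lo hi)
  ; split-shape = λ _ → split
  }
  where
  open ExpansionPair p
  m = 2 ^ suc t ∸ n
  extended₁ = extend-expansion t lo hi expansion₁

  split : SplitPair (extendTo (suc t) e₁) (extendTo (suc t) e₂)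
  split with power-or-between m (m<n⇒0<n∸m hi)
  ... | k , inj₁ m≡2^k       = extend-power-pair (suc t)
    (m≤n⇒m≤1+n (expansion-top-≤ t expansion₁ (complement-< t lo hi))) (power-shape (k , m≡2^k))
  ... | k , inj₂ (lo′ , hi′) = extend-split-pair (suc t) (split-shape (between⇒¬power k lo′ hi′))

  complete′ : ∀ e → Expansion n e → e ≡ extendTo (suc t) e₁ ⊎ e ≡ extendTo (suc t) e₂
  complete′ e x with expansion⇒extended t lo hi x
  ... | e′ , x′ , e≡ = Sum.map (λ eq → trans e≡ (cong (extendTo (suc t)) eq))
                               (λ eq → trans e≡ (cong (extendTo (suc t)) eq)) (complete e′ x′)

expansion-pair : ∀ n → 1 ≤ n → ExpansionPair n
expansion-pair = <-rec (λ n → 1 ≤ n → ExpansionPair n) step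
  where
  step : ∀ n → (∀ {m} → m < n → 1 ≤ m → ExpansionPair m) → 1 ≤ n → ExpansionPair n
  step n rec 1≤n with power-or-between n 1≤n
  ... | t , inj₁ refl        = power-pair t
  ... | t , inj₂ (lo , hi) = extend-pair t lo hi (rec (<-trans (complement-< t lo hi) lo) (m<n⇒0<n∸m hi))

lemma2p5 : (n : ℕ) → 1 ≤ n →
  Σ Tuple λ e₁ → Σ Tuple λ e₂ →
    Valid e₁ × Valid e₂ × A e₁ ≡ + n × A e₂ ≡ + n × e₁ ≢ e₂
    × (∀ e → Valid e → A e ≡ + n → e ≡ e₁ ⊎ e ≡ e₂)
    × HasOneForm e₁ × ¬ HasOneForm e₂
    × (IsPowerOf2 n →
         ∃ λ l₀ → e₁ ≡ (l₀ , 1 ∷ []) × e₂ ≡ (l₀ , []))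
    × (¬ IsPowerOf2 n →
         ∃ λ l₀ → ∃ λ l₂ → ∃ λ rest →
           e₁ ≡ (l₀ , 1 ∷ l₂ ∷ rest) × e₂ ≡ (l₀ , suc l₂ ∷ rest))
lemma2p5 n 1≤n =
  e₁ , e₂ , proj₁ expansion₁ , proj₁ expansion₂ , proj₂ expansion₁ , proj₂ expansion₂ ,
  (λ e₁≡e₂ → ¬one-form₂ (subst HasOneForm e₁≡e₂ one-form₁)) ,
  (λ e valid A≡n → complete e (valid , A≡n)) ,
  one-form₁ , ¬one-form₂ , power-shape , split-shape
  where open ExpansionPair (expansion-pair n 1≤n)
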